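{- Let $n\ge1$, $(m_1,\dots,m_n)$ a sequence of positive integers and $(j_2,\dots,j_n)$ a sequence of nonnegative integers. The number of lps tableaux over $\mathcal{A}_n$ with evaluation $(m_1,\dots,m_n)$ whose bottom row has evaluation $(m_1,j_2,\dots,j_n)$ equals $$\prod_{a=2}^{n}\binom{m_1+j_2+\cdots+j_{a-1}}{m_a-j_a}.$$
   Context: $\mathcal{A}_n=\{1<\cdots<n\}$. A composition diagram is a finite left-to-right sequence of nonempty bottom-justified columns of boxes; the bottom row consists of the lowest box of each column. An lps tableau over $\mathcal{A}_n$ is a filling of a composition diagram by elements of $\mathcal{A}_n$ such that each column is strictly increasing from bottom to top and the bottom row is weakly increasing from left to right. It has evaluation $(m_1,\dots,m_n)$ if each symbol $a$ occurs exactly $m_a$ times; the bottom row has evaluation $(e_1,\dots,e_n)$ if symbol $a$ occurs $e_a$ times in the bottom row. Binomial coefficients follow the convention $\binom{m}{k}=0$ if $k>m$ or $k<0$; the empty product is $1$. -}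

module Defs where

open import Data.Nat using (ℕ; zero; suc; _+_; _∸_; _≤ᵇ_)
open import Data.Nat.Combinatorics using (_C_)
open import Data.Bool using (if_then_else_)
open import Data.Fin using (Fin; zero; suc) renaming (_<_ to _<ᶠ_; _≤_ to _≤ᶠ_)
open import Data.Fin.Properties using (_≟_)
open import Data.List using (List; length; filter; map; concatMap)
open import Data.List.NonEmpty using (List⁺; head; toList)
open import Data.List.Relation.Unary.Linked using (Linked)
open import Data.Product using (_×_)
import Data.List.Relation.Unary.All
open import Function using (_∘_)

-- Symbols of A_n are represented by Fin n (Fin index i stands for symbol i+1).

-- A column is a nonempty list read from bottom to top; a diagram filling is a
-- left-to-right list of columns.
Column : ℕ → Set
Column n = List⁺ (Fin n)

Filling : ℕ → Set
Filling n = List (Column n)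

bottomRow : ∀ {n} → Filling n → List (Fin n)
bottomRow = map head

entries : ∀ {n} → Filling n → List (Fin n)
entries = concatMap toList

record IsLPS {n : ℕ} (t : Filling n) : Set where
  field
    columnsStrict : Data.List.Relation.Unary.All.All (λ c → Linked _<ᶠ_ (toList c)) t
    bottomWeak    : Linked _≤ᶠ_ (bottomRow t)

occ : ∀ {n} → Fin n → List (Fin n) → ℕ
occ a xs = length (filter (_≟ a) xs)

-- binomial coefficient with integer lower index k - j (k, j naturals):
-- binom N (k - j) = 0 when k - j < 0
binomDiff : ℕ → ℕ → ℕ → ℕ
binomDiff N k j = if j ≤ᵇ k then N C (k ∸ j) else 0

psum : ∀ {k} → (Fin k → ℕ) → Fin k → ℕ
psum f zero    = 0
psum f (suc i) = f zero + psum (f ∘ suc) i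

-- The bottom row of such a tableau is forced: it is the weakly increasing word B with evaluation
-- (m₁, j₂, …, jₙ). As columns increase strictly, a column is its bottom entry b together with the set
-- of symbols above it, all larger than b. So a tableau amounts to choosing, independently for every
-- symbol a ≥ 2, which m_a − j_a of the m₁ + j₂ + ⋯ + j_{a−1} columns whose bottom entry is smaller
-- than a receive an a. Building the tableaux by inserting the symbols from the largest one down,
-- each new symbol goes directly above the bottom box of the chosen columns, and every stage multiplies
-- the number of tableaux by the corresponding binomial coefficient.
module Submission where

open import Defs
open import Data.Nat using (ℕ; _≤_; _+_) renaming (suc to 1+)
open import Data.Fin using (Fin; zero; suc)
open import Data.List using (List; length; map; allFin)
open import Data.Nat.ListAction using (product)
open import Data.List.Membership.Propositional using (_∈_)
open import Data.List.Relation.Unary.Unique.Propositional using (Unique)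
open import Data.Product using (Σ; _×_)
open import Function.Bundles using (_⇔_)
open import Relation.Binary.PropositionalEquality using (_≡_)

open import Algebra.Properties.CommutativeSemigroup using (x∙yz≈y∙xz; interchange)
open import Data.Bool using (true; false)
open import Data.Fin using (_<_) renaming (_≤_ to _≤ᶠ_)
open import Data.Fin.Properties
  using (_≟_; _<?_; <-irrefl; <-trans; ≤-refl; ≤-trans; ≤-antisym; suc-injective)
open import Data.List using ([]; _∷_; _++_; [_]; concatMap; filter; replicate; tabulate)
open import Data.List.Membership.Propositional using (_∉_; lose; find)
open import Data.List.Membership.Propositional.Properties
  using (∈-map⁺; ∈-map⁻; ∈-++⁺ˡ; ∈-++⁺ʳ; ∈-++⁻; ∈-concatMap⁺; ∈-concatMap⁻; ∈-tabulate⁺; ∈-tabulate⁻)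
open import Data.List.NonEmpty using (head; tail; toList) renaming (_∷_ to _∷⁺_; [_] to [_]⁺)
open import Data.List.Properties
  using (length-++; length-map; length-replicate; filter-++; filter-all; filter-none;
         ∷-injectiveˡ; ∷-injectiveʳ; map-∘; map-id; map-tabulate; tabulate-cong)
open import Data.List.Relation.Binary.Disjoint.Propositional using (Disjoint)
open import Data.List.Relation.Unary.All as All using (All; []; _∷_)
import Data.List.Relation.Unary.All.Properties as All
open import Data.List.Relation.Unary.AllPairs as AllPairs using (AllPairs; []; _∷_)
import Data.List.Relation.Unary.AllPairs.Properties as AllPairs
open import Data.List.Relation.Unary.Any as Any using (Any; here; there)
open import Data.List.Relation.Unary.Linked as Linked using (Linked; []; [-]; _∷_)
import Data.List.Relation.Unary.Linked.Properties as Linked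
import Data.List.Relation.Unary.Unique.Propositional.Properties as Unique
open import Data.Nat using (_*_; _∸_; z≤n; s≤s; s<s; s<s⁻¹; _≤?_; _≤ᵇ_)
open import Data.Nat.Combinatorics using (_C_; nCk+nC[k+1]≡[n+1]C[k+1])
open import Data.Nat.ListAction using (sum)
open import Data.Nat.Properties
  using (+-comm; +-assoc; +-identityʳ; *-comm; *-identityʳ; *-zeroʳ; +-cancelˡ-≡; +-cancelʳ-≡;
         0≢1+n; 1+n≢n; m∸n+n≡m; m≤n+m; ≤⇒≤ᵇ; ≤ᵇ⇒≤; +-commutativeSemigroup)
open import Data.Product using (∃; ∃₂; _,_; proj₁; proj₂; map₂)
open import Data.Sum using (_⊎_; inj₁; inj₂)
open import Data.Unit using (tt)
open import Function using (_∘_; id; mk⇔; _⟨_⟩_)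
open import Function.Bundles using (Equivalence)
open import Function.Properties.Equivalence using () renaming (trans to ⇔-trans)
open import Relation.Binary.PropositionalEquality
  using (refl; sym; trans; cong; cong₂; subst; _≢_; module ≡-Reasoning)
open import Relation.Nullary using (yes; no; ¬_; contradiction)
open import Relation.Unary using (Decidable; _≐_; ∁)

Enumerates : ∀ {A : Set} → (A → Set) → List A → Set
Enumerates P L = Unique L × (∀ x → x ∈ L ⇔ P x)

Enumerates⇒All : ∀ {A : Set} {P : A → Set} {L} → Enumerates P L → All P L
Enumerates⇒All (_ , ∈L⇔P) = All.tabulate (λ {x} → Equivalence.to (∈L⇔P x))

count : ∀ {A : Set} {P : A → Set} → Decidable P → List A → ℕ
count P? = length ∘ filter P?

module _ {A : Set} {P : A → Set} (P? : Decidable P) where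

  count-++ : ∀ xs ys → count P? (xs ++ ys) ≡ count P? xs + count P? ys
  count-++ xs ys = trans (cong length (filter-++ P? xs ys)) (length-++ (filter P? xs))

  count-all : ∀ {xs} → All P xs → count P? xs ≡ length xs
  count-all Pxs = cong length (filter-all P? Pxs)

  count-none : ∀ {xs} → All (∁ P) xs → count P? xs ≡ 0
  count-none ¬Pxs = cong length (filter-none P? ¬Pxs)

  count-concatMap : ∀ {B : Set} (g : B → List A) xs →
    count P? (concatMap g xs) ≡ sum (map (count P? ∘ g) xs)
  count-concatMap g []       = refl
  count-concatMap g (x ∷ xs) =
    trans (count-++ (g x) (concatMap g xs)) (cong (count P? (g x) +_) (count-concatMap g xs))

  count≡1+⇒Any : ∀ xs {k} → count P? xs ≡ 1+ k → Any P xs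
  count≡1+⇒Any (x ∷ xs) count≡1+ with P? x
  ... | yes Px = here Px
  ... | no _   = there (count≡1+⇒Any xs count≡1+)

count-map : ∀ {A B : Set} {P : B → Set} {Q : A → Set} (P? : Decidable P) (Q? : Decidable Q)
  (h : A → B) → P ∘ h ≐ Q → ∀ xs → count P? (map h xs) ≡ count Q? xs
count-map P? Q? h _ [] = refl
count-map P? Q? h P∘h≐Q (x ∷ xs) with P? (h x) | Q? x
... | yes _   | yes _  = cong 1+ (count-map P? Q? h P∘h≐Q xs)
... | no _    | no _   = count-map P? Q? h P∘h≐Q xs
... | yes Phx | no ¬Qx = contradiction (proj₁ P∘h≐Q Phx) ¬Qx
... | no ¬Phx | yes Qx = contradiction (proj₂ P∘h≐Q Qx) ¬Phx

module _ {A B : Set} where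

  concatMap-unique : ∀ {Q : A → Set} (f : A → List B) →
    (∀ {x y z} → Q x → Q y → z ∈ f x → z ∈ f y → x ≡ y) → (∀ x → Unique (f x)) →
    ∀ {xs} → All Q xs → Unique xs → Unique (concatMap f xs)
  concatMap-unique {Q} f same-source f-unique {xs} Qxs xs-unique =
    Unique.concat⁺ (All.map⁺ (All.universal f-unique xs)) (AllPairs.map⁺ (disjoint Qxs xs-unique))
    where
    disjoint : ∀ {xs} → All Q xs → Unique xs → AllPairs (λ x y → Disjoint (f x) (f y)) xs
    disjoint []         []                     = []
    disjoint (Qx ∷ Qxs) (x∉xs ∷ xs-unique) =
      All.zipWith (λ (Qy , x≢y) {_} (z∈fx , z∈fy) → x≢y (same-source Qx Qy z∈fx z∈fy)) (Qxs , x∉xs)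
        ∷ disjoint Qxs xs-unique

  length-concatMap : ∀ (f : A → List B) {c xs} → All (λ x → length (f x) ≡ c) xs →
    length (concatMap f xs) ≡ length xs * c
  length-concatMap f [] = refl
  length-concatMap f {xs = x ∷ xs} (fx≡c ∷ fxs≡c) =
    trans (length-++ (f x)) (cong₂ _+_ fx≡c (length-concatMap f fxs≡c))

binomDiff-≤ : ∀ {N k j} → j ≤ k → binomDiff N k j ≡ N C (k ∸ j)
binomDiff-≤ {N} {k} {j} j≤k with j ≤ᵇ k | ≤⇒≤ᵇ j≤k
... | true  | _  = refl
... | false | ()

binomDiff-≰ : ∀ {N k j} → ¬ j ≤ k → binomDiff N k j ≡ 0
binomDiff-≰ {N} {k} {j} j≰k with j ≤ᵇ k | ≤ᵇ⇒≤ j k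
... | true  | j≤k = contradiction (j≤k tt) j≰k
... | false | _   = refl

module Marking {A : Set} {P : A → Set} (P? : Decidable P) (f : A → A) where

  data Marked : List A → List A → ℕ → Set where
    []   : Marked [] [] 0
    keep : ∀ {x xs ys r} → Marked xs ys r → Marked (x ∷ xs) (x ∷ ys) r
    mark : ∀ {x xs ys r} → P x → Marked xs ys r → Marked (x ∷ xs) (f x ∷ ys) (1+ r)

  marks : List A → ℕ → List (List A)
  marks xs       0      = [ xs ]
  marks []       (1+ r) = []
  marks (x ∷ xs) (1+ r) with P? x
  ... | yes _ = map (x ∷_) (marks xs (1+ r)) ++ map (f x ∷_) (marks xs r)
  ... | no _  = map (x ∷_) (marks xs (1+ r))

  unmarked : ∀ xs → Marked xs xs 0
  unmarked []       = []
  unmarked (x ∷ xs) = keep (unmarked xs)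

  Marked-0 : ∀ {xs ys} → Marked xs ys 0 → ys ≡ xs
  Marked-0 []       = refl
  Marked-0 (keep m) = cong (_ ∷_) (Marked-0 m)

  ∈-marks⁻ : ∀ xs r {ys} → ys ∈ marks xs r → Marked xs ys r
  ∈-marks⁻ xs 0 (here refl) = unmarked xs
  ∈-marks⁻ (x ∷ xs) (1+ r) ys∈ with P? x
  ... | no _ with ∈-map⁻ (x ∷_) ys∈
  ...   | _ , zs∈ , refl = keep (∈-marks⁻ xs (1+ r) zs∈)
  ∈-marks⁻ (x ∷ xs) (1+ r) ys∈ | yes Px with ∈-++⁻ (map (x ∷_) (marks xs (1+ r))) ys∈
  ... | inj₁ ys∈ˡ with ∈-map⁻ (x ∷_) ys∈ˡ
  ...   | _ , zs∈ , refl = keep (∈-marks⁻ xs (1+ r) zs∈)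
  ∈-marks⁻ (x ∷ xs) (1+ r) ys∈ | yes Px | inj₂ ys∈ʳ with ∈-map⁻ (f x ∷_) ys∈ʳ
  ...   | _ , zs∈ , refl = mark Px (∈-marks⁻ xs r zs∈)

  ∈-marks⁺ : ∀ {xs ys r} → Marked xs ys r → ys ∈ marks xs r
  ∈-marks⁺ {r = 0} m = here (Marked-0 m)
  ∈-marks⁺ {x ∷ xs} {r = 1+ r} (keep m) with P? x
  ... | yes _ = ∈-++⁺ˡ (∈-map⁺ (x ∷_) (∈-marks⁺ m))
  ... | no _  = ∈-map⁺ (x ∷_) (∈-marks⁺ m)
  ∈-marks⁺ {x ∷ xs} {r = 1+ r} (mark Px m) with P? x
  ... | yes _  = ∈-++⁺ʳ (map (x ∷_) (marks xs (1+ r))) (∈-map⁺ (f x ∷_) (∈-marks⁺ m))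
  ... | no ¬Px = contradiction Px ¬Px

  length-marks : ∀ xs r → length (marks xs r) ≡ count P? xs C r
  length-marks xs       0      = refl
  length-marks []       (1+ r) = refl
  length-marks (x ∷ xs) (1+ r) with P? x
  ... | no _  = trans (length-map (x ∷_) (marks xs (1+ r))) (length-marks xs (1+ r))
  ... | yes _ = begin
    length (map (x ∷_) (marks xs (1+ r)) ++ map (f x ∷_) (marks xs r))
      ≡⟨ length-++ (map (x ∷_) (marks xs (1+ r))) ⟩
    length (map (x ∷_) (marks xs (1+ r))) + length (map (f x ∷_) (marks xs r))
      ≡⟨ cong₂ _+_ (trans (length-map (x ∷_) (marks xs (1+ r))) (length-marks xs (1+ r)))
                   (trans (length-map (f x ∷_) (marks xs r)) (length-marks xs r)) ⟩
    N C 1+ r + N C r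
      ≡⟨ +-comm (N C 1+ r) (N C r) ⟩
    N C r + N C 1+ r
      ≡⟨ nCk+nC[k+1]≡[n+1]C[k+1] N r ⟩
    1+ N C 1+ r ∎
    where
    open ≡-Reasoning
    N = count P? xs

  marks-unique : (∀ {x} → P x → f x ≢ x) → ∀ xs r → Unique (marks xs r)
  marks-unique _  xs       0      = [] ∷ []
  marks-unique _  []       (1+ r) = []
  marks-unique f≢ (x ∷ xs) (1+ r) with P? x
  ... | no _  = Unique.map⁺ ∷-injectiveʳ (marks-unique f≢ xs (1+ r))
  ... | yes Px =
    Unique.++⁺ (Unique.map⁺ ∷-injectiveʳ (marks-unique f≢ xs (1+ r)))
               (Unique.map⁺ ∷-injectiveʳ (marks-unique f≢ xs r)) disjoint
    where
    disjoint : Disjoint (map (x ∷_) (marks xs (1+ r))) (map (f x ∷_) (marks xs r))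
    disjoint (ys∈ˡ , ys∈ʳ) with ∈-map⁻ (x ∷_) ys∈ˡ | ∈-map⁻ (f x ∷_) ys∈ʳ
    ... | _ , _ , refl | _ , _ , x∷≡fx∷ = f≢ Px (sym (∷-injectiveˡ x∷≡fx∷))

  Marked-map : ∀ {B : Set} (h : A → B) → (∀ x → h (f x) ≡ h x) →
    ∀ {xs ys r} → Marked xs ys r → map h ys ≡ map h xs
  Marked-map h hf≡h []             = refl
  Marked-map h hf≡h (keep m)       = cong (_ ∷_) (Marked-map h hf≡h m)
  Marked-map h hf≡h (mark {x} _ m) = cong₂ _∷_ (hf≡h x) (Marked-map h hf≡h m)

  Marked-All : ∀ {Q R : A → Set} → (∀ {x} → Q x → R x) → (∀ {x} → P x → Q x → R (f x)) →
    ∀ {xs ys r} → Marked xs ys r → All Q xs → All R ys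
  Marked-All Q⇒R mark⇒R []          []         = []
  Marked-All Q⇒R mark⇒R (keep m)    (Qx ∷ Qxs) = Q⇒R Qx ∷ Marked-All Q⇒R mark⇒R m Qxs
  Marked-All Q⇒R mark⇒R (mark Px m) (Qx ∷ Qxs) = mark⇒R Px Qx ∷ Marked-All Q⇒R mark⇒R m Qxs

  Marked-sum : ∀ (w : A → ℕ) d → (∀ {x} → P x → w (f x) ≡ d + w x) →
    ∀ {xs ys r} → Marked xs ys r → sum (map w ys) ≡ r * d + sum (map w xs)
  Marked-sum w d wf []                      = refl
  Marked-sum w d wf (keep {x} {xs} {r = r} m) =
    trans (cong (w x +_) (Marked-sum w d wf m)) (x∙yz≈y∙xz +-commutativeSemigroup (w x) (r * d) _)
  Marked-sum w d wf (mark {x} {xs} {r = r} Px m) =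
    trans (cong₂ _+_ (wf Px) (Marked-sum w d wf m)) (interchange +-commutativeSemigroup d (w x) (r * d) _)

  Marked-sources-unique : ∀ {Q : A → Set} → (∀ {x y} → f x ≡ f y → x ≡ y) → (∀ {x y} → Q x → f y ≢ x) →
    ∀ {xs ys zs r r′} → All Q xs → All Q ys → Marked xs zs r → Marked ys zs r′ → xs ≡ ys
  Marked-sources-unique {Q} f-injective Q≢f Qxs Qys m m′ = sources m m′ refl Qxs Qys
    where
    sources : ∀ {xs ys zs zs′ r r′} → Marked xs zs r → Marked ys zs′ r′ → zs ≡ zs′ →
      All Q xs → All Q ys → xs ≡ ys
    sources []         []          _  _          _          = refl
    sources (keep m)   (keep m′)   eq (_ ∷ Qxs) (_ ∷ Qys) =
      cong₂ _∷_ (∷-injectiveˡ eq) (sources m m′ (∷-injectiveʳ eq) Qxs Qys)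
    sources (mark _ m) (mark _ m′) eq (_ ∷ Qxs) (_ ∷ Qys) =
      cong₂ _∷_ (f-injective (∷-injectiveˡ eq)) (sources m m′ (∷-injectiveʳ eq) Qxs Qys)
    sources (keep _)   (mark _ _)  eq (Qx ∷ _)  _        = contradiction (sym (∷-injectiveˡ eq)) (Q≢f Qx)
    sources (mark _ _) (keep _)    eq _         (Qy ∷ _) = contradiction (∷-injectiveˡ eq) (Q≢f Qy)

  unmark : ∀ {Q R : A → Set} → (∀ {y} → R y → Q y ⊎ ∃ λ x → P x × Q x × f x ≡ y) →
    ∀ {ys} → All R ys → ∃₂ λ xs r → Marked xs ys r × All Q xs
  unmark split [] = [] , 0 , [] , []
  unmark split (Ry ∷ Rys) with unmark split Rys | split Ry
  ... | xs , r , m , Qxs | inj₁ Qy                   = _ ∷ xs , r , keep m , Qy ∷ Qxs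
  ... | xs , r , m , Qxs | inj₂ (x , Px , Qx , refl) = x ∷ xs , 1+ r , mark Px m , Qx ∷ Qxs

module _ {n : ℕ} where

  occ-self : ∀ (a : Fin n) → occ a [ a ] ≡ 1
  occ-self a = count-all (_≟ a) (refl ∷ [])

  occ-other : ∀ {a σ : Fin n} → a ≢ σ → occ a [ σ ] ≡ 0
  occ-other a≢σ = count-none (_≟ _) ((λ σ≡a → a≢σ (sym σ≡a)) ∷ [])

  occ-head : ∀ (x : Fin n) xs → occ x (x ∷ xs) ≡ 1+ (occ x xs)
  occ-head x xs = trans (count-++ (_≟ x) [ x ] xs) (cong (_+ occ x xs) (occ-self x))

  occ-absent : ∀ {a : Fin n} {σs xs} → a ∉ σs → All (_∈ σs) xs → occ a xs ≡ 0
  occ-absent a∉σs xs∈σs = count-none (_≟ _) (All.map (λ { x∈σs refl → a∉σs x∈σs }) xs∈σs)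

  sorted-occ-unique : ∀ {xs ys : List (Fin n)} → Linked _≤ᶠ_ xs → Linked _≤ᶠ_ ys →
    (∀ a → occ a xs ≡ occ a ys) → xs ≡ ys
  sorted-occ-unique {[]}     {[]}     _ _ _    = refl
  sorted-occ-unique {[]}     {y ∷ ys} _ _ same = contradiction (trans (same y) (occ-head y ys)) 0≢1+n
  sorted-occ-unique {x ∷ xs} {[]}     _ _ same = contradiction (trans (sym (same x)) (occ-head x xs)) 0≢1+n
  sorted-occ-unique {x ∷ xs} {y ∷ ys} x∷xs↗ y∷ys↗ same =
    cong₂ _∷_ x≡y (sorted-occ-unique (Linked.tail x∷xs↗) (Linked.tail y∷ys↗) same-tails)
    where
    minimum : ∀ {z zs w} → Linked _≤ᶠ_ (z ∷ zs) → w ∈ z ∷ zs → z ≤ᶠ w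
    minimum z∷zs↗ = All.lookup (Linked.Linked⇒All ≤-trans ≤-refl z∷zs↗)
    occurs : ∀ a zs us → occ a zs ≡ occ a (a ∷ us) → a ∈ zs
    occurs a zs us eq = Any.map sym (count≡1+⇒Any (_≟ a) zs (trans eq (occ-head a us)))
    x≡y : x ≡ y
    x≡y = ≤-antisym (minimum x∷xs↗ (occurs y (x ∷ xs) ys (same y)))
                    (minimum y∷ys↗ (occurs x (y ∷ ys) xs (sym (same x))))
    same-tails : ∀ a → occ a xs ≡ occ a ys
    same-tails a = +-cancelˡ-≡ (occ a [ x ]) _ _ (begin
      occ a [ x ] + occ a xs  ≡⟨ count-++ (_≟ a) [ x ] xs ⟨
      occ a (x ∷ xs)          ≡⟨ trans (same a) (cong (λ z → occ a (z ∷ ys)) (sym x≡y)) ⟩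
      occ a (x ∷ ys)          ≡⟨ count-++ (_≟ a) [ x ] ys ⟩
      occ a [ x ] + occ a ys  ∎)
      where open ≡-Reasoning

  ∉-above : ∀ {σ : Fin n} {σs} → All (σ <_) σs → σ ∉ σs
  ∉-above σ<σs σ∈σs = <-irrefl refl (All.lookup σ<σs σ∈σs)

  ∈-∷-above : ∀ {σ x : Fin n} {σs} → σ < x → x ∈ σ ∷ σs → x ∈ σs
  ∈-∷-above σ<x (here refl)  = contradiction σ<x (<-irrefl refl)
  ∈-∷-above _   (there x∈σs) = x∈σs

  ∈-∷-all-above : ∀ {σ : Fin n} {σs xs} → All (σ <_) xs → All (_∈ σ ∷ σs) xs → All (_∈ σs) xs
  ∈-∷-all-above σ<xs xs∈ = All.zipWith (λ (σ<y , y∈) → ∈-∷-above σ<y y∈) (σ<xs , xs∈)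

  uppers : Filling n → List (Fin n)
  uppers = concatMap tail

  occ-entries : ∀ a t → occ a (entries t) ≡ occ a (bottomRow t) + occ a (uppers t)
  occ-entries a []      = refl
  occ-entries a (c ∷ t) = begin
    occ a ([ head c ] ++ tail c ++ entries t)
      ≡⟨ count-++ (_≟ a) [ head c ] (tail c ++ entries t) ⟩
    h + occ a (tail c ++ entries t)
      ≡⟨ cong (h +_) (trans (count-++ (_≟ a) (tail c) (entries t)) (cong (u +_) (occ-entries a t))) ⟩
    h + (u + (occ a (bottomRow t) + occ a (uppers t)))
      ≡⟨ cong (h +_) (x∙yz≈y∙xz +-commutativeSemigroup u (occ a (bottomRow t)) (occ a (uppers t))) ⟩
    h + (occ a (bottomRow t) + (u + occ a (uppers t)))
      ≡⟨ +-assoc h (occ a (bottomRow t)) (u + occ a (uppers t)) ⟨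
    (h + occ a (bottomRow t)) + (u + occ a (uppers t))
      ≡⟨ cong₂ _+_ (count-++ (_≟ a) [ head c ] (bottomRow t)) (count-++ (_≟ a) (tail c) (uppers t)) ⟨
    occ a (head c ∷ bottomRow t) + occ a (tail c ++ uppers t) ∎
    where
    open ≡-Reasoning
    h = occ a [ head c ]
    u = occ a (tail c)

  insertAboveBottom : Fin n → Column n → Column n
  insertAboveBottom σ (b ∷⁺ bs) = b ∷⁺ σ ∷ bs

  head-insertAboveBottom : ∀ σ c → head (insertAboveBottom σ c) ≡ head c
  head-insertAboveBottom σ (_ ∷⁺ _) = refl

  occ-tail-insertAboveBottom : ∀ a σ c →
    occ a (tail (insertAboveBottom σ c)) ≡ occ a [ σ ] + occ a (tail c)
  occ-tail-insertAboveBottom a σ (_ ∷⁺ bs) = count-++ (_≟ a) [ σ ] bs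

  insertAboveBottom-≢ : ∀ {σ c} → insertAboveBottom σ c ≢ c
  insertAboveBottom-≢ {c = _ ∷⁺ _} eq = 1+n≢n (cong (length ∘ tail) eq)

  insertAboveBottom-injective : ∀ {σ c c′} →
    insertAboveBottom σ c ≡ insertAboveBottom σ c′ → c ≡ c′
  insertAboveBottom-injective {c = _ ∷⁺ _} {_ ∷⁺ _} refl = refl

  ColumnWithin : List (Fin n) → Column n → Set
  ColumnWithin σs c = Linked _<_ (toList c) × All (_∈ σs) (tail c)

  uppers-within : ∀ {σs t} → All (ColumnWithin σs) t → All (_∈ σs) (uppers t)
  uppers-within = All.concat⁺ ∘ All.map⁺ ∘ All.map proj₂

  within-weaken : ∀ {σ σs c} → ColumnWithin σs c → ColumnWithin (σ ∷ σs) c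
  within-weaken = map₂ (All.map there)

  insert-within : ∀ {σ σs c} → All (σ <_) σs → head c < σ → ColumnWithin σs c →
    ColumnWithin (σ ∷ σs) (insertAboveBottom σ c)
  insert-within {c = b ∷⁺ []}    _    b<σ (_ , [])                  = b<σ ∷ [-] , here refl ∷ []
  insert-within {c = b ∷⁺ _ ∷ _} σ<σs b<σ (_ ∷ bs↗ , x∈σs ∷ xs∈σs) =
    b<σ ∷ All.lookup σ<σs x∈σs ∷ bs↗ , here refl ∷ there x∈σs ∷ All.map there xs∈σs

  inserted≢within : ∀ {σ σs c c′} → All (σ <_) σs → ColumnWithin σs c →
    insertAboveBottom σ c′ ≢ c
  inserted≢within {c′ = _ ∷⁺ _} σ<σs (_ , σ∈σs ∷ _) refl = ∉-above σ<σs σ∈σs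

  within-split : ∀ {σ σs c} → All (σ <_) σs → ColumnWithin (σ ∷ σs) c →
    ColumnWithin σs c ⊎ ∃ λ c′ → head c′ < σ × ColumnWithin σs c′ × insertAboveBottom σ c′ ≡ c
  within-split {c = _ ∷⁺ []} _ (b↗ , []) = inj₁ (b↗ , [])
  within-split {c = b ∷⁺ _ ∷ xs} _ (b∷σ∷xs↗ , here refl ∷ xs∈)
    with Linked.Linked⇒AllPairs <-trans b∷σ∷xs↗
  ... | (b<σ ∷ b<xs) ∷ σ<xs ∷ xs↗ =
    inj₂ (b ∷⁺ xs , b<σ , (Linked.AllPairs⇒Linked (b<xs ∷ xs↗) , ∈-∷-all-above σ<xs xs∈) , refl)
  within-split {c = _ ∷⁺ _ ∷ _} σ<σs (b<x ∷ x∷xs↗ , there x∈σs ∷ xs∈) =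
    inj₁ (b<x ∷ x∷xs↗ , x∈σs ∷ ∈-∷-all-above σ<xs xs∈)
    where
    σ<xs = All.tail (Linked.Linked⇒All <-trans (All.lookup σ<σs x∈σs) x∷xs↗)

module FixedBottomRow {n : ℕ} (B : List (Fin n)) (m : Fin n → ℕ) where

  -- An lps tableau of evaluation m and bottom row B, with every entry above the bottom row that is
  -- not in σs deleted.
  record Admissible (σs : List (Fin n)) (t : Filling n) : Set where
    field
      bottom  : bottomRow t ≡ B
      columns : All (ColumnWithin σs) t
      counts  : ∀ {a} → a ∈ σs → occ a B + occ a (uppers t) ≡ m a

  open Admissible public

  module Insert (σ : Fin n) = Marking (λ (c : Column n) → head c <? σ) (insertAboveBottom σ)

  bottomRow-marked : ∀ {σ s t r} → Insert.Marked σ s t r → bottomRow t ≡ bottomRow s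
  bottomRow-marked {σ} = Insert.Marked-map σ head (head-insertAboveBottom σ)

  occ-uppers-marked : ∀ {σ a s t r} → Insert.Marked σ s t r →
    occ a (uppers t) ≡ r * occ a [ σ ] + occ a (uppers s)
  occ-uppers-marked {σ} {a} {s} {t} {r} marked = begin
    occ a (uppers t)
      ≡⟨ count-concatMap (_≟ a) tail t ⟩
    sum (map (occ a ∘ tail) t)
      ≡⟨ Insert.Marked-sum σ (occ a ∘ tail) _ (λ {c} _ → occ-tail-insertAboveBottom a σ c) marked ⟩
    r * occ a [ σ ] + sum (map (occ a ∘ tail) s)
      ≡⟨ cong (r * occ a [ σ ] +_) (count-concatMap (_≟ a) tail s) ⟨
    r * occ a [ σ ] + occ a (uppers s) ∎
    where open ≡-Reasoning

  occ-uppers-inserted : ∀ {σ σs s t r} → All (σ <_) σs → All (ColumnWithin σs) s →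
    Insert.Marked σ s t r → occ σ (uppers t) ≡ r
  occ-uppers-inserted {σ} {s = s} {t} {r} σ<σs cols marked = begin
    occ σ (uppers t)                    ≡⟨ occ-uppers-marked marked ⟩
    r * occ σ [ σ ] + occ σ (uppers s)  ≡⟨ cong₂ _+_ (cong (r *_) (occ-self σ)) σ-absent ⟩
    r * 1 + 0                           ≡⟨ trans (+-identityʳ (r * 1)) (*-identityʳ r) ⟩
    r                                   ∎
    where
    open ≡-Reasoning
    σ-absent = occ-absent (∉-above σ<σs) (uppers-within cols)

  occ-uppers-untouched : ∀ {σ a s t r} → a ≢ σ → Insert.Marked σ s t r →
    occ a (uppers t) ≡ occ a (uppers s)
  occ-uppers-untouched {a = a} {s} {r = r} a≢σ marked = occ-uppers-marked marked ⟨ trans ⟩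
    cong (_+ occ a (uppers s)) (trans (cong (r *_) (occ-other a≢σ)) (*-zeroʳ r))

  marked-admissible : ∀ {σ σs s t r} → All (σ <_) σs → Admissible σs s → Insert.Marked σ s t r →
    r + occ σ B ≡ m σ → Admissible (σ ∷ σs) t
  marked-admissible {σ} {σs} {s} {t} {r} σ<σs adm marked r+occ≡m = record
    { bottom  = trans (bottomRow-marked marked) (bottom adm)
    ; columns = Insert.Marked-All σ within-weaken (insert-within σ<σs) marked (columns adm)
    ; counts  = counts-t
    }
    where
    counts-t : ∀ {a} → a ∈ σ ∷ σs → occ a B + occ a (uppers t) ≡ m a
    counts-t (here refl) = cong (occ σ B +_) (occ-uppers-inserted σ<σs (columns adm) marked) ⟨ trans ⟩
      +-comm (occ σ B) r ⟨ trans ⟩ r+occ≡m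
    counts-t {a} (there a∈σs) =
      cong (occ a B +_) (occ-uppers-untouched (λ { refl → ∉-above σ<σs a∈σs }) marked) ⟨ trans ⟩
      counts adm a∈σs

  admissible-unmark : ∀ {σ σs t} → All (σ <_) σs → Admissible (σ ∷ σs) t →
    ∃₂ λ s r → Admissible σs s × Insert.Marked σ s t r × r + occ σ B ≡ m σ
  admissible-unmark {σ} {σs} {t} σ<σs adm with Insert.unmark σ (within-split σ<σs) (columns adm)
  ... | s , r , marked , cols = s , r , adm-s , marked , r+occ≡m
    where
    adm-s : Admissible σs s
    adm-s = record
      { bottom  = trans (sym (bottomRow-marked marked)) (bottom adm)
      ; columns = cols
      ; counts  = λ {a} a∈σs →
          cong (occ a B +_) (sym (occ-uppers-untouched (λ { refl → ∉-above σ<σs a∈σs }) marked))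
          ⟨ trans ⟩ counts adm (there a∈σs)
      }
    r+occ≡m : r + occ σ B ≡ m σ
    r+occ≡m = +-comm r (occ σ B) ⟨ trans ⟩
      cong (occ σ B +_) (sym (occ-uppers-inserted σ<σs cols marked)) ⟨ trans ⟩ counts adm (here refl)

  admissible⇒occ≤m : ∀ {σ σs t} → All (σ <_) σs → Admissible (σ ∷ σs) t → occ σ B ≤ m σ
  admissible⇒occ≤m {σ} σ<σs adm with admissible-unmark σ<σs adm
  ... | _ , r , _ , _ , r+occ≡m = subst (occ σ B ≤_) r+occ≡m (m≤n+m (occ σ B) r)

  insertions : Fin n → ℕ → List (Filling n) → List (Filling n)
  insertions σ r = concatMap (λ s → Insert.marks σ s r)

  insertions-unique : ∀ {σ σs r E} → All (σ <_) σs → All (Admissible σs) E → Unique E →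
    Unique (insertions σ r E)
  insertions-unique {σ} {r = r} σ<σs =
    concatMap-unique (λ s → Insert.marks σ s r) same-source
      (λ s → Insert.marks-unique σ (λ _ → insertAboveBottom-≢) s r)
    where
    same-source : ∀ {s s′ t} → Admissible _ s → Admissible _ s′ →
      t ∈ Insert.marks σ s r → t ∈ Insert.marks σ s′ r → s ≡ s′
    same-source {s} {s′} adm adm′ t∈ t∈′ =
      Insert.Marked-sources-unique σ insertAboveBottom-injective (inserted≢within σ<σs)
        (columns adm) (columns adm′) (Insert.∈-marks⁻ σ s r t∈) (Insert.∈-marks⁻ σ s′ r t∈′)

  insertions-enumerates : ∀ {σ σs r E} → All (σ <_) σs → r + occ σ B ≡ m σ →
    Enumerates (Admissible σs) E → Enumerates (Admissible (σ ∷ σs)) (insertions σ r E)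
  insertions-enumerates {σ} {σs} {r} {E} σ<σs r+occ≡m E-enum@(E-unique , ∈E⇔) =
    insertions-unique {r = r} σ<σs (Enumerates⇒All E-enum) E-unique , λ _ → mk⇔ sound complete
    where
    sound : ∀ {t} → t ∈ insertions σ r E → Admissible (σ ∷ σs) t
    sound t∈ with find (∈-concatMap⁻ (λ s → Insert.marks σ s r) t∈)
    ... | s , s∈E , t∈marks =
      marked-admissible σ<σs (Equivalence.to (∈E⇔ s) s∈E) (Insert.∈-marks⁻ σ s r t∈marks) r+occ≡m

    complete : ∀ {t} → Admissible (σ ∷ σs) t → t ∈ insertions σ r E
    complete {t} adm with admissible-unmark σ<σs adm
    ... | s , r′ , adm-s , marked , r′+occ≡m =
      ∈-concatMap⁺ (λ s → Insert.marks σ s r) (lose (Equivalence.from (∈E⇔ s) adm-s) t∈marks)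
      where
      r′≡r : r′ ≡ r
      r′≡r = +-cancelʳ-≡ (occ σ B) r′ r (trans r′+occ≡m (sym r+occ≡m))
      t∈marks : t ∈ Insert.marks σ s r
      t∈marks = Insert.∈-marks⁺ σ (subst (Insert.Marked σ s t) r′≡r marked)

  length-insertions : ∀ {σ r E} → All (λ s → bottomRow s ≡ B) E →
    length (insertions σ r E) ≡ (count (_<? σ) B C r) * length E
  length-insertions {σ} {r} {E} bottoms =
    trans (length-concatMap (λ s → Insert.marks σ s r) (All.map length-marks bottoms)) (*-comm (length E) _)
    where
    length-marks : ∀ {s} → bottomRow s ≡ B → length (Insert.marks σ s r) ≡ count (_<? σ) B C r
    length-marks {s} bottom-s = Insert.length-marks σ s r ⟨ trans ⟩ cong (_C r)
      (sym (count-map (_<? σ) (λ c → head c <? σ) head (id , id) s) ⟨ trans ⟩ cong (count (_<? σ)) bottom-s)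

  step : Fin n → List (Filling n) → List (Filling n)
  step σ E with occ σ B ≤? m σ
  ... | yes _ = insertions σ (m σ ∸ occ σ B) E
  ... | no _  = []

  factor : Fin n → ℕ
  factor σ = binomDiff (count (_<? σ) B) (m σ) (occ σ B)

  step-enumerates : ∀ {σ σs E} → All (σ <_) σs → Enumerates (Admissible σs) E →
    Enumerates (Admissible (σ ∷ σs)) (step σ E)
  step-enumerates {σ} σ<σs E-enum with occ σ B ≤? m σ
  ... | yes occ≤m = insertions-enumerates σ<σs (m∸n+n≡m occ≤m) E-enum
  ... | no occ≰m  = [] , λ _ → mk⇔ (λ ()) (λ adm → contradiction (admissible⇒occ≤m σ<σs adm) occ≰m)

  length-step : ∀ {σ E} → All (λ s → bottomRow s ≡ B) E → length (step σ E) ≡ factor σ * length E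
  length-step {σ} {E} bottoms with occ σ B ≤? m σ
  ... | yes occ≤m = length-insertions {r = m σ ∸ occ σ B} bottoms ⟨ trans ⟩
    cong (_* length E) (sym (binomDiff-≤ occ≤m))
  ... | no occ≰m  = cong (_* length E) (sym (binomDiff-≰ occ≰m))

  tableaux : List (Fin n) → List (Filling n)
  tableaux []       = [ map [_]⁺ B ]
  tableaux (σ ∷ σs) = step σ (tableaux σs)

  singletons-admissible : Admissible [] (map [_]⁺ B)
  singletons-admissible = record
    { bottom  = trans (sym (map-∘ B)) (map-id B)
    ; columns = All.map⁺ (All.universal (λ _ → [-] , []) B)
    ; counts  = λ ()
    }

  admissible-[]-singletons : ∀ {t} → Admissible [] t → t ≡ map [_]⁺ B
  admissible-[]-singletons adm = trans (no-uppers (columns adm)) (cong (map [_]⁺) (bottom adm))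
    where
    no-uppers : ∀ {t} → All (ColumnWithin []) t → t ≡ map [_]⁺ (bottomRow t)
    no-uppers []                                      = refl
    no-uppers {(_ ∷⁺ []) ∷ _}    (_ ∷ cols)          = cong (_ ∷_) (no-uppers cols)
    no-uppers {(_ ∷⁺ _ ∷ _) ∷ _} ((_ , () ∷ _) ∷ _)

  tableaux-enumerates : ∀ {σs} → AllPairs _<_ σs → Enumerates (Admissible σs) (tableaux σs)
  tableaux-enumerates [] =
    [] ∷ [] , λ _ → mk⇔ (λ { (here refl) → singletons-admissible }) (here ∘ admissible-[]-singletons)
  tableaux-enumerates (σ<σs ∷ σs↗) = step-enumerates σ<σs (tableaux-enumerates σs↗)

  length-tableaux : ∀ {σs} → AllPairs _<_ σs → length (tableaux σs) ≡ product (map factor σs)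
  length-tableaux []                = refl
  length-tableaux {σ ∷ _} (_ ∷ σs↗) =
    trans (length-step (All.map bottom (Enumerates⇒All (tableaux-enumerates σs↗))))
          (cong (factor σ *_) (length-tableaux σs↗))

sortedRow : ∀ {n} → (Fin n → ℕ) → List (Fin n)
sortedRow {0}    e = []
sortedRow {1+ n} e = replicate (e zero) zero ++ map suc (sortedRow (e ∘ suc))

sortedRow-sorted : ∀ {n} (e : Fin n → ℕ) → Linked _≤ᶠ_ (sortedRow e)
sortedRow-sorted {0}    e = []
sortedRow-sorted {1+ n} e = zeros (e zero) (Linked.map⁺ (Linked.map s≤s (sortedRow-sorted (e ∘ suc))))
  where
  zero∷ : ∀ {xs : List (Fin (1+ n))} → Linked _≤ᶠ_ xs → Linked _≤ᶠ_ (zero ∷ xs)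
  zero∷ {[]}    _   = [-]
  zero∷ {_ ∷ _} xs↗ = z≤n ∷ xs↗
  zeros : ∀ r {xs} → Linked _≤ᶠ_ xs → Linked _≤ᶠ_ (replicate r zero ++ xs)
  zeros 0      xs↗ = xs↗
  zeros (1+ r) xs↗ = zero∷ (zeros r xs↗)

occ-sortedRow : ∀ {n} (e : Fin n → ℕ) a → occ a (sortedRow e) ≡ e a
occ-sortedRow {1+ n} e a = count-++ (_≟ a) (replicate (e zero) zero) (map suc rest) ⟨ trans ⟩ split a
  where
  rest = sortedRow (e ∘ suc)
  split : ∀ a → occ a (replicate (e zero) zero) + occ a (map suc rest) ≡ e a
  split zero = cong₂ _+_
    (trans (count-all (_≟ zero) (All.replicate⁺ (e zero) refl)) (length-replicate (e zero)))
    (count-none (_≟ zero) (All.map⁺ {f = suc} (All.universal (λ _ ()) rest)))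
    ⟨ trans ⟩ +-identityʳ (e zero)
  split (suc a) = cong₂ _+_
    (count-none (_≟ suc a) (All.replicate⁺ (e zero) (λ ())))
    (count-map (_≟ suc a) (_≟ a) suc (suc-injective , cong suc) rest)
    ⟨ trans ⟩ occ-sortedRow (e ∘ suc) a

count-<-sortedRow : ∀ {n} (e : Fin n → ℕ) i → count (_<? i) (sortedRow e) ≡ psum e i
count-<-sortedRow {1+ n} e zero = count-none (_<? zero {n}) (All.universal (λ _ ()) (sortedRow e))
count-<-sortedRow {1+ n} e (suc i) =
  count-++ (_<? suc i) (replicate (e zero) zero) (map suc rest) ⟨ trans ⟩ cong₂ _+_
    (trans (count-all (_<? suc i) (All.replicate⁺ (e zero) (s≤s z≤n))) (length-replicate (e zero)))
    (trans (count-map (_<? suc i) (_<? i) suc (s<s⁻¹ , s<s) rest) (count-<-sortedRow (e ∘ suc) i))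
  where
  rest = sortedRow (e ∘ suc)

module CanonicalBottomRow {k : ℕ} (m : Fin (1+ k) → ℕ) (j : Fin k → ℕ) where

  bottomEvaluation : Fin (1+ k) → ℕ
  bottomEvaluation zero    = m zero
  bottomEvaluation (suc i) = j i

  open FixedBottomRow (sortedRow bottomEvaluation) m public

  nonzero : List (Fin (1+ k))
  nonzero = tabulate suc

  nonzero-increasing : AllPairs _<_ nonzero
  nonzero-increasing = AllPairs.tabulate⁺-< s<s

  zero∉nonzero : zero ∉ nonzero
  zero∉nonzero zero∈ with ∈-tabulate⁻ zero∈
  ... | _ , ()

  above⇒nonzero : ∀ {b x : Fin (1+ k)} → b < x → x ∈ nonzero
  above⇒nonzero {x = suc i} _ = ∈-tabulate⁺ i

  IsTableau : Filling (1+ k) → Set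
  IsTableau t = IsLPS t
    × (∀ a → occ a (entries t) ≡ m a)
    × occ zero (bottomRow t) ≡ m zero
    × (∀ i → occ (suc i) (bottomRow t) ≡ j i)

  admissible⇔IsTableau : ∀ t → Admissible nonzero t ⇔ IsTableau t
  admissible⇔IsTableau t = mk⇔ to from
    where
    to : Admissible nonzero t → IsTableau t
    to adm = lps , evaluation , bottom-occ zero , bottom-occ ∘ suc
      where
      lps : IsLPS t
      lps = record
        { columnsStrict = All.map proj₁ (columns adm)
        ; bottomWeak    = subst (Linked _≤ᶠ_) (sym (bottom adm)) (sortedRow-sorted bottomEvaluation)
        }
      bottom-occ : ∀ a → occ a (bottomRow t) ≡ bottomEvaluation a
      bottom-occ a = trans (cong (occ a) (bottom adm)) (occ-sortedRow bottomEvaluation a)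
      evaluation : ∀ a → occ a (entries t) ≡ m a
      evaluation zero = occ-entries zero t ⟨ trans ⟩
        cong₂ _+_ (bottom-occ zero) (occ-absent zero∉nonzero (uppers-within (columns adm))) ⟨ trans ⟩
        +-identityʳ (m zero)
      evaluation (suc i) = occ-entries (suc i) t ⟨ trans ⟩
        cong (_+ occ (suc i) (uppers t)) (cong (occ (suc i)) (bottom adm)) ⟨ trans ⟩
        counts adm (∈-tabulate⁺ i)

    from : IsTableau t → Admissible nonzero t
    from (lps , evaluation , bottom-zero , bottom-suc) = record
      { bottom  = bottom-t
      ; columns = All.map strict⇒within (IsLPS.columnsStrict lps)
      ; counts  = λ {a} _ →
          cong (_+ occ a (uppers t)) (cong (occ a) (sym bottom-t)) ⟨ trans ⟩
          sym (occ-entries a t) ⟨ trans ⟩ evaluation a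
      }
      where
      bottom-occ : ∀ a → occ a (bottomRow t) ≡ bottomEvaluation a
      bottom-occ zero    = bottom-zero
      bottom-occ (suc i) = bottom-suc i
      bottom-t : bottomRow t ≡ sortedRow bottomEvaluation
      bottom-t = sorted-occ-unique (IsLPS.bottomWeak lps) (sortedRow-sorted bottomEvaluation)
        (λ a → trans (bottom-occ a) (sym (occ-sortedRow bottomEvaluation a)))
      strict⇒within : ∀ {c} → Linked _<_ (toList c) → ColumnWithin nonzero c
      strict⇒within c↗ =
        c↗ , All.map above⇒nonzero (AllPairs.head (Linked.Linked⇒AllPairs <-trans c↗))

  product-factors : product (map factor nonzero)
    ≡ product (map (λ i → binomDiff (m zero + psum j i) (m (suc i)) (j i)) (allFin k))
  product-factors = cong product (begin
    map factor (tabulate suc)  ≡⟨ map-tabulate suc factor ⟩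
    tabulate (factor ∘ suc)    ≡⟨ tabulate-cong factor-suc ⟩
    tabulate f                 ≡⟨ map-tabulate id f ⟨
    map f (allFin k)           ∎)
    where
    open ≡-Reasoning
    f = λ i → binomDiff (m zero + psum j i) (m (suc i)) (j i)
    factor-suc : ∀ i → factor (suc i) ≡ f i
    factor-suc i = cong₂ (λ N J → binomDiff N (m (suc i)) J)
      (count-<-sortedRow bottomEvaluation (suc i)) (occ-sortedRow bottomEvaluation (suc i))

lemma4p2 : (k : ℕ) (m : Fin (1+ k) → ℕ) (j : Fin k → ℕ) →
    (∀ a → 1 ≤ m a) →
    Σ (List (Filling (1+ k))) λ L →
      Unique L
      × (∀ t → (t ∈ L) ⇔
           (IsLPS t
            × (∀ a → occ a (entries t) ≡ m a)
            × occ zero (bottomRow t) ≡ m zero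
            × (∀ i → occ (suc i) (bottomRow t) ≡ j i)))
      × length L ≡ product (map (λ i → binomDiff (m zero + psum j i) (m (suc i)) (j i)) (allFin k))
lemma4p2 k m j _ =
  tableaux nonzero ,
  proj₁ enumeration ,
  (λ t → ⇔-trans (proj₂ enumeration t) (admissible⇔IsTableau t)) ,
  trans (length-tableaux nonzero-increasing) product-factors
  where
  open CanonicalBottomRow m j
  enumeration = tableaux-enumerates nonzero-increasing
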